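{- Let $n\ge 45$, let $a$ be an integer with $\lceil (n+7)/5\rceil\le a\le \lfloor (n-11)/3\rfloor$ and $n-a\equiv 1\pmod 2$, and let $b=\tfrac12(n-3a-1)$. Then for every integer $c$ with $b+2\le c\le a-2$, the integer $\binom a2-c$ is an eigenvalue of $\mathrm{Cay}(S_n,T_n)$; more precisely, the following partitions of $n$ correspond to these eigenvalues: (i) $\binom a2-c$ for $c=b+2,\dots,\lfloor (a+b)/2\rfloor$: $(a,\ a+b-c+2,\ c+1,\ 4,\ 2\times(c-3),\ 1\times(a+b-2c))$; (ii) $\binom a2-c$ for $c=\lfloor (a+b)/2\rfloor,\dots,a-2$: $(a,\ c+1,\ a+b-c-1,\ 6\times 2,\ 2\times(a+b-c-7),\ 1\times(2c-a-b+3))$.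
   Context: $\mathrm{Cay}(S_n,T_n)$ is the Cayley graph on the symmetric group $S_n$ generated by the set $T_n$ of all transpositions ($f\sim g$ iff $fg^{ -1}\in T_n$). For a partition $\lambda=(\lambda_1,\dots,\lambda_k)$ of $n$ (parts listed in the order written), put $\rho_\lambda=\sum_{i=1}^k \lambda_i(\lambda_i-2i+1)/2$; the eigenvalues of $\mathrm{Cay}(S_n,T_n)$ are exactly the numbers $\rho_\lambda$ as $\lambda$ ranges over partitions of $n$, and $\lambda$ is said to correspond to the eigenvalue $\rho_\lambda$. The notation $(\mu_1\times t_1,\dots,\mu_r\times t_r)$ denotes the sequence in which $\mu_i$ is repeated $t_i$ times; an entry $\mu$ without "$\times t$" is a single part, and $\mu\times 0$ contributes no parts. -}

module Defs where

open import Data.Nat as ℕ using (ℕ; zero; suc; _≤_; _<_; _∸_)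
open import Data.Integer as ℤ using (ℤ; +_)
open import Data.Integer.DivMod using (_/ℕ_)
open import Data.List using (List; []; _∷_; replicate; _++_)
open import Data.Nat.ListAction using (sum)
open import Data.List.Relation.Unary.All using (All)
open import Data.List.Relation.Unary.Linked using (Linked)
open import Data.Product using (Σ; _×_)
open import Relation.Binary.PropositionalEquality using (_≡_)

record Partition (n : ℕ) (λs : List ℕ) : Set where
  field
    positive   : All (λ p → 0 < p) λs
    decreasing : Linked ℕ._≥_ λs
    total      : sum λs ≡ n

-- The i-th summand (i 1-indexed) λᵢ(λᵢ - 2i + 1)/2 (always an exact division).
ρterm : ℕ → ℕ → ℤ
ρterm i p = ((+ p) ℤ.* ((+ p) ℤ.- (+ 2) ℤ.* (+ i) ℤ.+ (+ 1))) /ℕ 2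

ρ-from : ℕ → List ℕ → ℤ
ρ-from i [] = + 0
ρ-from i (p ∷ ps) = ρterm i p ℤ.+ ρ-from (suc i) ps

ρ : List ℕ → ℤ
ρ = ρ-from 1

Corresponds : ℕ → List ℕ → ℤ → Set
Corresponds n λs x = Partition n λs × ρ λs ≡ x

-- x is an eigenvalue of Cay(S_n,T_n): by the stated characterization,
-- x = ρ_λ for some partition λ of n.
IsEigenvalueCayST : ℕ → ℤ → Set
IsEigenvalueCayST n x = Σ (List ℕ) (λ λs → Corresponds n λs x)

_×ᵣ_ : ℕ → ℕ → List ℕ
μ ×ᵣ t = replicate t μ

{-# OPTIONS --safe #-}
-- The first part a of each partition contributes ρterm 1 a = C(a,2) to ρ, so it remains to see that
-- the remaining parts contribute −c.  Doubling ρ clears the division by 2 in ρterm: the doubled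
-- contribution is an integer polynomial in the offsets that parametrise the partition, and the claim
-- becomes a ring identity.  The bound on a and the parity of n − a give n = 3a + 2b + 1 with b ≥ 5,
-- which makes the parts add up to n; that they decrease follows from b + 2 ≤ c ≤ a − 2 together with
-- the side of (a + b)/2 on which c lies.
module Submission where

open import Data.Empty using (⊥-elim)
open import Data.List using (List; []; _∷_; _++_; length; replicate)
open import Data.List.Properties using (length-replicate)
open import Data.List.Relation.Unary.All using (All; _∷_)
open import Data.List.Relation.Unary.All.Properties using (++⁺; replicate⁺)
open import Data.List.Relation.Unary.Linked using (Linked; [-]; _∷_)
open import Data.Nat.Combinatorics using (_C_; nC1≡n; nCk+nC[k+1]≡[n+1]C[k+1])
open import Data.Nat.ListAction using (sum)
open import Data.Nat.ListAction.Properties using (sum-++)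
open import Data.Product using (_×_; _,_; ∃; proj₁; proj₂)
open import Data.Sum using ([_,_]′)
open import Relation.Binary.PropositionalEquality using (_≡_; refl; sym; trans; cong; cong₂; subst; subst₂; module ≡-Reasoning)
open import Defs

open import Data.Nat using (ℕ)
import Data.Nat as ℕ
import Data.Nat.DivMod as ℕ
import Data.Nat.Properties as ℕ

-- Partitions (i) and (ii) in offset coordinates: (i) has c = 3 + s and r = a + b − 2c ones;
-- (ii) has c = 6 + s + k, s = a + b − c − 7 twos and 2 + k = 2c + 3 − (a + b) ones.
family-i : ℕ → ℕ → ℕ → List ℕ
family-i a s r = a ∷ (5 ℕ.+ s ℕ.+ r) ∷ (4 ℕ.+ s) ∷ 4 ∷ (2 ×ᵣ s ++ 1 ×ᵣ r)

family-ii : ℕ → ℕ → ℕ → List ℕ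
family-ii a s k = a ∷ (7 ℕ.+ s ℕ.+ k) ∷ (6 ℕ.+ s) ∷ 6 ∷ 6 ∷ (2 ×ᵣ s ++ 1 ×ᵣ (2 ℕ.+ k))

module ρ-Computation where

  open import Data.Integer using (ℤ; +_; -[1+_]; _+_; _*_; _-_; -_; _/ℕ_)
  open import Data.Integer.Properties using (pos-*; *-comm; *-cancelˡ-≡; *-distribˡ-+; +-identityˡ; +-assoc)
  open import Data.Integer.Tactic.RingSolver using (solve-∀)
  open ≡-Reasoning

  i*n/ℕn≡i : ∀ i n .{{_ : ℕ.NonZero n}} → (i * + n) /ℕ n ≡ i
  i*n/ℕn≡i (+ m) n = trans (cong (_/ℕ n) (sym (pos-* m n))) (cong +_ (ℕ.m*n/n≡m m n))
  -- the same case split as in the definition of _/ℕ_ on negative dividends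
  i*n/ℕn≡i -[1+ m ] (ℕ.suc n) with ℕ.suc m ℕ.* ℕ.suc n ℕ.% ℕ.suc n in eq
  ... | ℕ.zero = cong (λ k → - (+ k)) (ℕ.m*n/n≡m (ℕ.suc m) (ℕ.suc n))
  ... | ℕ.suc _ = ⊥-elim (ℕ.1+n≢0 (trans (sym eq) (ℕ.m*n%n≡0 (ℕ.suc m) (ℕ.suc n))))

  2*nC2+n≡n*n : ∀ n → + 2 * + (n C 2) + + n ≡ + n * + n
  2*nC2+n≡n*n ℕ.zero = refl
  2*nC2+n≡n*n (ℕ.suc n) = begin
    + 2 * + (ℕ.suc n C 2) + + ℕ.suc n         ≡⟨ cong (λ k → + 2 * + k + + ℕ.suc n) (sym (nCk+nC[k+1]≡[n+1]C[k+1] n 1)) ⟩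
    + 2 * + (n C 1 ℕ.+ n C 2) + + ℕ.suc n     ≡⟨ cong (λ k → + 2 * + (k ℕ.+ n C 2) + + ℕ.suc n) (nC1≡n n) ⟩
    + 2 * (+ n + + (n C 2)) + (+ 1 + + n)     ≡⟨ regroup (+ n) (+ (n C 2)) ⟩
    (+ 2 * + (n C 2) + + n) + + 2 * + n + + 1 ≡⟨ cong (λ k → k + + 2 * + n + + 1) (2*nC2+n≡n*n n) ⟩
    + n * + n + + 2 * + n + + 1               ≡⟨ square (+ n) ⟩
    (+ 1 + + n) * (+ 1 + + n) ∎
    where
    regroup : ∀ N K → + 2 * (N + K) + (+ 1 + N) ≡ (+ 2 * K + N) + + 2 * N + + 1
    regroup = solve-∀
    square : ∀ N → N * N + + 2 * N + + 1 ≡ (+ 1 + N) * (+ 1 + N)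
    square = solve-∀

  -- Inlined so that the ring solver sees through these abbreviations.
  2ρterm : ℤ → ℤ → ℤ
  2ρterm i p = p * (p - + 2 * i + + 1)
  {-# INLINE 2ρterm #-}

  2ρ-replicate : ℤ → ℤ → ℤ → ℤ
  2ρ-replicate i t p = t * p * (p + + 2 - + 2 * i - t)
  {-# INLINE 2ρ-replicate #-}

  2ρterm≡[pC2+p-ip]*2 : ∀ i p → 2ρterm (+ i) (+ p) ≡ (+ (p C 2) + + p - + i * + p) * + 2
  2ρterm≡[pC2+p-ip]*2 i p = begin
    2ρterm (+ i) (+ p)                              ≡⟨ expand (+ i) (+ p) ⟩
    + p * + p + + p - + 2 * (+ i * + p)             ≡⟨ cong (λ t → t + + p - + 2 * (+ i * + p)) (sym (2*nC2+n≡n*n p)) ⟩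
    + 2 * + (p C 2) + + p + + p - + 2 * (+ i * + p) ≡⟨ collect (+ (p C 2)) (+ p) (+ i * + p) ⟩
    (+ (p C 2) + + p - + i * + p) * + 2             ∎
    where
    expand : ∀ I P → 2ρterm I P ≡ P * P + P - + 2 * (I * P)
    expand = solve-∀
    collect : ∀ K P Q → + 2 * K + P + P - + 2 * Q ≡ (K + P - Q) * + 2
    collect = solve-∀

  2*ρterm≡2ρterm : ∀ i p → + 2 * ρterm i p ≡ 2ρterm (+ i) (+ p)
  2*ρterm≡2ρterm i p = begin
    + 2 * (2ρterm (+ i) (+ p) /ℕ 2) ≡⟨ cong (λ t → + 2 * (t /ℕ 2)) (2ρterm≡[pC2+p-ip]*2 i p) ⟩
    + 2 * ((q * + 2) /ℕ 2)          ≡⟨ cong (+ 2 *_) (i*n/ℕn≡i q 2) ⟩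
    + 2 * q                          ≡⟨ *-comm (+ 2) q ⟩
    q * + 2                          ≡⟨ sym (2ρterm≡[pC2+p-ip]*2 i p) ⟩
    2ρterm (+ i) (+ p)               ∎
    where q = + (p C 2) + + p - + i * + p

  ρterm1a≡aC2 : ∀ a → ρterm 1 a ≡ + (a C 2)
  ρterm1a≡aC2 a = *-cancelˡ-≡ (+ 2) _ _ (begin
    + 2 * ρterm 1 a                 ≡⟨ 2*ρterm≡2ρterm 1 a ⟩
    2ρterm (+ 1) (+ a)              ≡⟨ expand (+ a) ⟩
    + a * + a - + a                 ≡⟨ cong (_- + a) (sym (2*nC2+n≡n*n a)) ⟩
    + 2 * + (a C 2) + + a - + a     ≡⟨ cancel (+ 2 * + (a C 2)) (+ a) ⟩
    + 2 * + (a C 2)                 ∎)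
    where
    expand : ∀ A → 2ρterm (+ 1) A ≡ A * A - A
    expand = solve-∀
    cancel : ∀ X A → X + A - A ≡ X
    cancel = solve-∀

  2ρ-from : ℕ → List ℕ → ℤ
  2ρ-from i []       = + 0
  2ρ-from i (p ∷ ps) = 2ρterm (+ i) (+ p) + 2ρ-from (ℕ.suc i) ps

  2*ρ-from≡2ρ-from : ∀ i ps → + 2 * ρ-from i ps ≡ 2ρ-from i ps
  2*ρ-from≡2ρ-from i []       = refl
  2*ρ-from≡2ρ-from i (p ∷ ps) = trans (*-distribˡ-+ (+ 2) (ρterm i p) (ρ-from (ℕ.suc i) ps))
    (cong₂ _+_ (2*ρterm≡2ρterm i p) (2*ρ-from≡2ρ-from (ℕ.suc i) ps))

  2ρ-from-++ : ∀ i xs ys → 2ρ-from i (xs ++ ys) ≡ 2ρ-from i xs + 2ρ-from (length xs ℕ.+ i) ys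
  2ρ-from-++ i []       ys = sym (+-identityˡ _)
  2ρ-from-++ i (x ∷ xs) ys = begin
    t + 2ρ-from (ℕ.suc i) (xs ++ ys)                             ≡⟨ cong (_+_ t) (2ρ-from-++ (ℕ.suc i) xs ys) ⟩
    t + (2ρ-from (ℕ.suc i) xs + 2ρ-from (length xs ℕ.+ ℕ.suc i) ys) ≡⟨ sym (+-assoc t (2ρ-from (ℕ.suc i) xs) _) ⟩
    t + 2ρ-from (ℕ.suc i) xs + 2ρ-from (length xs ℕ.+ ℕ.suc i) ys   ≡⟨ cong (λ j → t + 2ρ-from (ℕ.suc i) xs + 2ρ-from j ys) (ℕ.+-suc (length xs) i) ⟩
    t + 2ρ-from (ℕ.suc i) xs + 2ρ-from (ℕ.suc (length xs ℕ.+ i)) ys ∎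
    where t = 2ρterm (+ i) (+ x)

  2ρ-from-replicate : ∀ i t p → 2ρ-from i (replicate t p) ≡ 2ρ-replicate (+ i) (+ t) (+ p)
  2ρ-from-replicate i ℕ.zero    p = empty (+ i) (+ p)
    where
    empty : ∀ I P → + 0 ≡ 2ρ-replicate I (+ 0) P
    empty = solve-∀
  2ρ-from-replicate i (ℕ.suc t) p = begin
    2ρterm (+ i) (+ p) + 2ρ-from (ℕ.suc i) (replicate t p)      ≡⟨ cong (_+_ (2ρterm (+ i) (+ p))) (2ρ-from-replicate (ℕ.suc i) t p) ⟩
    2ρterm (+ i) (+ p) + 2ρ-replicate (+ 1 + + i) (+ t) (+ p)   ≡⟨ peel (+ i) (+ t) (+ p) ⟩
    2ρ-replicate (+ i) (+ 1 + + t) (+ p)                         ∎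
    where
    peel : ∀ I T P → 2ρterm I P + 2ρ-replicate (+ 1 + I) T P ≡ 2ρ-replicate I (+ 1 + T) P
    peel = solve-∀

  2ρ-from-2ˢ1ʳ : ∀ i hs s r → let j = length hs ℕ.+ i in
    2ρ-from i (hs ++ 2 ×ᵣ s ++ 1 ×ᵣ r) ≡ 2ρ-from i hs + (2ρ-replicate (+ j) (+ s) (+ 2) + 2ρ-replicate (+ s + + j) (+ r) (+ 1))
  2ρ-from-2ˢ1ʳ i hs s r = begin
    2ρ-from i (hs ++ 2 ×ᵣ s ++ 1 ×ᵣ r)                                   ≡⟨ 2ρ-from-++ i hs _ ⟩
    2ρ-from i hs + 2ρ-from j (2 ×ᵣ s ++ 1 ×ᵣ r)                         ≡⟨ cong (_+_ (2ρ-from i hs)) (2ρ-from-++ j (2 ×ᵣ s) (1 ×ᵣ r)) ⟩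
    2ρ-from i hs + (2ρ-from j (2 ×ᵣ s) + 2ρ-from (length (2 ×ᵣ s) ℕ.+ j) (1 ×ᵣ r))
      ≡⟨ cong (λ k → 2ρ-from i hs + (2ρ-from j (2 ×ᵣ s) + 2ρ-from (k ℕ.+ j) (1 ×ᵣ r))) (length-replicate s) ⟩
    2ρ-from i hs + (2ρ-from j (2 ×ᵣ s) + 2ρ-from (s ℕ.+ j) (1 ×ᵣ r))
      ≡⟨ cong (_+_ (2ρ-from i hs)) (cong₂ _+_ (2ρ-from-replicate j s 2) (2ρ-from-replicate (s ℕ.+ j) r 1)) ⟩
    2ρ-from i hs + (2ρ-replicate (+ j) (+ s) (+ 2) + 2ρ-replicate (+ s + + j) (+ r) (+ 1)) ∎
    where j = length hs ℕ.+ i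

  ρ-from-2ˢ1ʳ : ∀ i hs s r {x} → let j = length hs ℕ.+ i in
    2ρ-from i hs + (2ρ-replicate (+ j) (+ s) (+ 2) + 2ρ-replicate (+ s + + j) (+ r) (+ 1)) ≡ + 2 * x →
    ρ-from i (hs ++ 2 ×ᵣ s ++ 1 ×ᵣ r) ≡ x
  ρ-from-2ˢ1ʳ i hs s r eq = *-cancelˡ-≡ (+ 2) _ _
    (trans (2*ρ-from≡2ρ-from i (hs ++ 2 ×ᵣ s ++ 1 ×ᵣ r)) (trans (2ρ-from-2ˢ1ʳ i hs s r) eq))

  ρ-family-i : ∀ a s r → ρ (family-i a s r) ≡ + (a C 2) - + (3 ℕ.+ s)
  ρ-family-i a s r = cong₂ _+_ (ρterm1a≡aC2 a)
    (ρ-from-2ˢ1ʳ 2 ((5 ℕ.+ s ℕ.+ r) ∷ (4 ℕ.+ s) ∷ 4 ∷ []) s r (2ρ-tail≡-2c (+ s) (+ r)))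
    where
    2ρ-tail≡-2c : ∀ S R →
      2ρterm (+ 2) (+ 5 + S + R) + (2ρterm (+ 3) (+ 4 + S) + (2ρterm (+ 4) (+ 4) + + 0))
        + (2ρ-replicate (+ 5) S (+ 2) + 2ρ-replicate (S + + 5) R (+ 1))
      ≡ + 2 * - (+ 3 + S)
    2ρ-tail≡-2c = solve-∀

  ρ-family-ii : ∀ a s k → ρ (family-ii a s k) ≡ + (a C 2) - + (6 ℕ.+ s ℕ.+ k)
  ρ-family-ii a s k = cong₂ _+_ (ρterm1a≡aC2 a)
    (ρ-from-2ˢ1ʳ 2 ((7 ℕ.+ s ℕ.+ k) ∷ (6 ℕ.+ s) ∷ 6 ∷ 6 ∷ []) s (2 ℕ.+ k) (2ρ-tail≡-2c (+ s) (+ k)))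
    where
    2ρ-tail≡-2c : ∀ S K →
      2ρterm (+ 2) (+ 7 + S + K) + (2ρterm (+ 3) (+ 6 + S) + (2ρterm (+ 4) (+ 6) + (2ρterm (+ 5) (+ 6) + + 0)))
        + (2ρ-replicate (+ 6) S (+ 2) + 2ρ-replicate (S + + 6) (+ 2 + K) (+ 1))
      ≡ + 2 * - (+ 6 + S + K)
    2ρ-tail≡-2c = solve-∀

open ρ-Computation using (ρ-family-i; ρ-family-ii)

open import Data.Nat using (zero; suc; _+_; _*_; _∸_; _≤_; _<_; _≥_; _/_; _%_; z≤n; s≤s)
open import Data.Nat.Divisibility using (_∣_; divides)
open import Data.Nat.Properties
  using (≤-refl; ≤-trans; ≤-total; ≤-pred; <⇒≤; n≤1+n; m≤n⇒m≤1+n; m≤m+n; m≤n+m; m≤n⇒∃[o]m+o≡n;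
         +-assoc; +-comm; *-comm; +-cancelʳ-≤; +-cancelˡ-≤; +-mono-≤; +-monoʳ-≤; +-monoˡ-≤; *-monoʳ-≤; *-monoˡ-≤;
         m+n∸m≡n; m+[n∸m]≡n; m≤o∸n⇒m+n≤o; m∸n≢0⇒n<m; m<n⇒n≢0; module ≤-Reasoning)
open import Data.Nat.DivMod using (m*n/n≡m; m/n*n≤m; m≡m%n+[m/n]*n; m%n<n; [m+kn]%n≡m%n)
open import Data.Nat.Tactic.RingSolver using (solve-∀)
open import Data.Integer using (+_; _-_)

m≡n+o⇒m∸n≡o : ∀ {m} n {o} → m ≡ n + o → m ∸ n ≡ o
m≡n+o⇒m∸n≡o n {o} refl = m+n∸m≡n n o

sum-replicate : ∀ t p → sum (replicate t p) ≡ t * p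
sum-replicate zero    p = refl
sum-replicate (suc t) p = cong (_+_ p) (sum-replicate t p)

sum-2ˢ1ʳ : ∀ s r → sum (2 ×ᵣ s ++ 1 ×ᵣ r) ≡ s * 2 + r * 1
sum-2ˢ1ʳ s r = trans (sum-++ (2 ×ᵣ s) (1 ×ᵣ r)) (cong₂ _+_ (sum-replicate s 2) (sum-replicate r 1))

2ˢ1ʳ-positive : ∀ s r → All (0 <_) (2 ×ᵣ s ++ 1 ×ᵣ r)
2ˢ1ʳ-positive s r = ++⁺ (replicate⁺ s (s≤s z≤n)) (replicate⁺ r (s≤s z≤n))

1ʳ-linked : ∀ {p} r → 1 ≤ p → Linked _≥_ (p ∷ 1 ×ᵣ r)
1ʳ-linked zero    _   = [-]
1ʳ-linked (suc r) 1≤p = 1≤p ∷ 1ʳ-linked r ≤-refl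

2ˢ1ʳ-linked : ∀ {p} s r → 2 ≤ p → Linked _≥_ (p ∷ (2 ×ᵣ s ++ 1 ×ᵣ r))
2ˢ1ʳ-linked zero    r 2≤p = 1ʳ-linked r (≤-trans (s≤s z≤n) 2≤p)
2ˢ1ʳ-linked (suc s) r 2≤p = 2≤p ∷ 2ˢ1ʳ-linked s r ≤-refl

partition-family-i : ∀ {a} s r → 5 + s + r ≤ a → Partition (a + 4 * s + 2 * r + 13) (family-i a s r)
partition-family-i {a} s r bound = record
  { positive   = ≤-trans (s≤s z≤n) bound ∷ s≤s z≤n ∷ s≤s z≤n ∷ s≤s z≤n ∷ 2ˢ1ʳ-positive s r
  ; decreasing = bound ∷ m≤n⇒m≤1+n (m≤m+n (4 + s) r) ∷ m≤m+n 4 s ∷ 2ˢ1ʳ-linked s r (s≤s (s≤s z≤n))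
  ; total      = trans (cong (λ t → a + (5 + s + r + (4 + s + (4 + t)))) (sum-2ˢ1ʳ s r)) (total-eq a s r)
  }
  where
  total-eq : ∀ a s r → a + (5 + s + r + (4 + s + (4 + (s * 2 + r * 1)))) ≡ a + 4 * s + 2 * r + 13
  total-eq = solve-∀

partition-family-ii : ∀ {a} s k → 7 + s + k ≤ a → Partition (a + 4 * s + 2 * k + 27) (family-ii a s k)
partition-family-ii {a} s k bound = record
  { positive   = ≤-trans (s≤s z≤n) bound ∷ s≤s z≤n ∷ s≤s z≤n ∷ s≤s z≤n ∷ s≤s z≤n ∷ 2ˢ1ʳ-positive s (2 + k)
  ; decreasing = bound ∷ m≤n⇒m≤1+n (m≤m+n (6 + s) k) ∷ m≤m+n 6 s ∷ ≤-refl ∷ 2ˢ1ʳ-linked s (2 + k) (s≤s (s≤s z≤n))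
  ; total      = trans (cong (λ t → a + (7 + s + k + (6 + s + (6 + (6 + t))))) (sum-2ˢ1ʳ s (2 + k))) (total-eq a s k)
  }
  where
  total-eq : ∀ a s k → a + (7 + s + k + (6 + s + (6 + (6 + (s * 2 + (2 + k) * 1))))) ≡ a + 4 * s + 2 * k + 27
  total-eq = solve-∀

corresponds-family-i : ∀ {n a x y t} s r → 5 + s + r ≤ a → n ≡ a + 4 * s + 2 * r + 13 →
  x ≡ 5 + s + r → y ≡ 4 + s → t ≡ r → Corresponds n (a ∷ x ∷ y ∷ 4 ∷ (2 ×ᵣ s ++ 1 ×ᵣ t)) (+ (a C 2) - + (3 + s))
corresponds-family-i {a = a} s r bound refl refl refl refl = partition-family-i s r bound , ρ-family-i a s r

corresponds-family-ii : ∀ {n a x y u t} s k → 7 + s + k ≤ a → n ≡ a + 4 * s + 2 * k + 27 →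
  x ≡ 7 + s + k → y ≡ 6 + s → u ≡ s → t ≡ 2 + k →
  Corresponds n (a ∷ x ∷ y ∷ 6 ∷ 6 ∷ (2 ×ᵣ u ++ 1 ×ᵣ t)) (+ (a C 2) - + (6 + s + k))
corresponds-family-ii {a = a} s k bound refl refl refl refl refl = partition-family-ii s k bound , ρ-family-ii a s k

corresponds-i-offsets : ∀ {n a m c} s r → n ≡ a + 2 * m + 1 → 3 + s ≡ c → 2 * c + r ≡ m → m + 2 ≤ a + c →
  Corresponds n (a ∷ (m + 2 ∸ c) ∷ (c + 1) ∷ 4 ∷ ((2 ×ᵣ (c ∸ 3)) ++ (1 ×ᵣ (m ∸ 2 * c)))) (+ (a C 2) - + c)
corresponds-i-offsets {a = a} s r n≡ refl refl m+2≤a+c =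
  corresponds-family-i s r bound (trans n≡ (total a s r))
    (m≡n+o⇒m∸n≡o (3 + s) (split s r)) (+-comm (3 + s) 1) (m+n∸m≡n (2 * (3 + s)) r)
  where
  total : ∀ a s r → a + 2 * (2 * (3 + s) + r) + 1 ≡ a + 4 * s + 2 * r + 13
  total = solve-∀
  split : ∀ s r → 2 * (3 + s) + r + 2 ≡ 3 + s + (5 + s + r)
  split = solve-∀
  bound : 5 + s + r ≤ a
  bound = +-cancelʳ-≤ (3 + s) (5 + s + r) a (subst (_≤ a + (3 + s)) (regroup s r) m+2≤a+c)
    where
    regroup : ∀ s r → 2 * (3 + s) + r + 2 ≡ 5 + s + r + (3 + s)
    regroup = solve-∀

corresponds-ii-offsets : ∀ {n a m c} s k → n ≡ a + 2 * m + 1 → c + 7 + s ≡ m → 6 + s + k ≡ c → c + 2 ≤ a →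
  Corresponds n (a ∷ (c + 1) ∷ (m ∸ c ∸ 1) ∷ ((6 ×ᵣ 2) ++ ((2 ×ᵣ (m ∸ c ∸ 7)) ++ (1 ×ᵣ (2 * c + 3 ∸ m))))) (+ (a C 2) - + c)
corresponds-ii-offsets {a = a} s k n≡ refl refl c+2≤a =
  corresponds-family-ii s k bound (trans n≡ (total a s k))
    (+-comm (6 + s + k) 1) (cong (_∸ 1) m∸c≡7+s) (cong (_∸ 7) m∸c≡7+s) (m≡n+o⇒m∸n≡o (6 + s + k + 7 + s) (split s k))
  where
  total : ∀ a s k → a + 2 * (6 + s + k + 7 + s) + 1 ≡ a + 4 * s + 2 * k + 27
  total = solve-∀
  m∸c≡7+s : 6 + s + k + 7 + s ∸ (6 + s + k) ≡ 7 + s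
  m∸c≡7+s = m≡n+o⇒m∸n≡o (6 + s + k) (+-assoc (6 + s + k) 7 s)
  split : ∀ s k → 2 * (6 + s + k) + 3 ≡ 6 + s + k + 7 + s + (2 + k)
  split = solve-∀
  bound : 7 + s + k ≤ a
  bound = ≤-trans (n≤1+n (7 + s + k)) (subst (_≤ a) (+-comm (6 + s + k) 2) c+2≤a)

m≤n/2⇒2*m≤n : ∀ {m n} → m ≤ n / 2 → 2 * m ≤ n
m≤n/2⇒2*m≤n {n = n} m≤n/2 = ≤-trans (*-monoʳ-≤ 2 m≤n/2) (subst (_≤ n) (*-comm (n / 2) 2) (m/n*n≤m n 2))

m/2≤n⇒m≤2*n+1 : ∀ {m n} → m / 2 ≤ n → m ≤ 2 * n + 1
m/2≤n⇒m≤2*n+1 {m} {n} m/2≤n = begin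
  m                   ≡⟨ m≡m%n+[m/n]*n m 2 ⟩
  m % 2 + m / 2 * 2   ≤⟨ +-mono-≤ (≤-pred (m%n<n m 2)) (*-monoˡ-≤ 2 m/2≤n) ⟩
  1 + n * 2           ≡⟨ +-comm 1 (n * 2) ⟩
  n * 2 + 1           ≡⟨ cong (_+ 1) (*-comm n 2) ⟩
  2 * n + 1           ∎
  where open ≤-Reasoning

corresponds-i : ∀ {n} a b {c} → n ≡ 3 * a + 2 * b + 1 → 5 ≤ b → b + 2 ≤ c → c ≤ (a + b) / 2 →
  Corresponds n (a ∷ (a + b + 2 ∸ c) ∷ (c + 1) ∷ 4 ∷ ((2 ×ᵣ (c ∸ 3)) ++ (1 ×ᵣ (a + b ∸ 2 * c)))) (+ (a C 2) - + c)
corresponds-i a b {c} n≡ 5≤b b+2≤c c≤[a+b]/2 =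
  corresponds-i-offsets (c ∸ 3) (a + b ∸ 2 * c) (trans n≡ (regroup a b)) (m+[n∸m]≡n 3≤c) (m+[n∸m]≡n (m≤n/2⇒2*m≤n c≤[a+b]/2))
    (subst (_≤ a + c) (sym (+-assoc a b 2)) (+-monoʳ-≤ a b+2≤c))
  where
  regroup : ∀ a b → 3 * a + 2 * b + 1 ≡ a + 2 * (a + b) + 1
  regroup = solve-∀
  3≤c : 3 ≤ c
  3≤c = ≤-trans (+-monoˡ-≤ 2 (≤-trans (s≤s z≤n) 5≤b)) b+2≤c

corresponds-ii : ∀ {n} a b {c} → n ≡ 3 * a + 2 * b + 1 → 5 ≤ b → b + 2 ≤ c → c ≤ a ∸ 2 → (a + b) / 2 ≤ c →
  Corresponds n (a ∷ (c + 1) ∷ (a + b ∸ c ∸ 1) ∷ ((6 ×ᵣ 2) ++ ((2 ×ᵣ (a + b ∸ c ∸ 7)) ++ (1 ×ᵣ (2 * c + 3 ∸ (a + b)))))) (+ (a C 2) - + c)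
corresponds-ii a b {c} n≡ 5≤b b+2≤c c≤a∸2 [a+b]/2≤c =
  corresponds-ii-offsets s (c ∸ (6 + s)) (trans n≡ (regroup a b)) (m+[n∸m]≡n c+7≤a+b) (m+[n∸m]≡n 6+s≤c) c+2≤a
  where
  regroup : ∀ a b → 3 * a + 2 * b + 1 ≡ a + 2 * (a + b) + 1
  regroup = solve-∀
  c+2≤a : c + 2 ≤ a
  c+2≤a = m≤o∸n⇒m+n≤o c 2≤a c≤a∸2
    where
    2≤a : 2 ≤ a
    2≤a = <⇒≤ (m∸n≢0⇒n<m (m<n⇒n≢0 (≤-trans (≤-trans (m≤n+m 2 b) b+2≤c) c≤a∸2)))
  c+7≤a+b : c + 7 ≤ a + b
  c+7≤a+b = subst (_≤ a + b) (+-assoc c 2 5) (+-mono-≤ c+2≤a 5≤b)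
  s : ℕ
  s = a + b ∸ (c + 7)
  6+s≤c : 6 + s ≤ c
  6+s≤c = +-cancelˡ-≤ c (6 + s) c (≤-pred (subst₂ _≤_ (shift c s) (double c) c+7+s≤2c+1))
    where
    c+7+s≤2c+1 : c + 7 + s ≤ 2 * c + 1
    c+7+s≤2c+1 = subst (_≤ 2 * c + 1) (sym (m+[n∸m]≡n c+7≤a+b)) (m/2≤n⇒m≤2*n+1 [a+b]/2≤c)
    shift : ∀ c s → c + 7 + s ≡ suc (c + (6 + s))
    shift = solve-∀
    double : ∀ c → 2 * c + 1 ≡ suc (c + c)
    double = solve-∀

[1+n]%2≡1⇒2∣n : ∀ n → suc n % 2 ≡ 1 → 2 ∣ n
[1+n]%2≡1⇒2∣n zero          _   = divides 0 refl
[1+n]%2≡1⇒2∣n (suc zero)    ()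
[1+n]%2≡1⇒2∣n (suc (suc n)) odd with [1+n]%2≡1⇒2∣n n odd
... | divides q n≡q*2 = divides (suc q) (cong (_+_ 2) n≡q*2)

n≡a*3+11+i*2 : ∀ {n} a → a * 3 + 11 ≤ n → (n ∸ a) % 2 ≡ 1 → ∃ λ i → n ≡ a * 3 + 11 + i * 2
n≡a*3+11+i*2 a a*3+11≤n = decompose (m≤n⇒∃[o]m+o≡n a*3+11≤n)
  where
  regroup : ∀ a j → a * 3 + 11 + j ≡ a + (suc j + (5 + a) * 2)
  regroup = solve-∀
  parity : ∀ j → (a * 3 + 11 + j ∸ a) % 2 ≡ 1 → suc j % 2 ≡ 1
  parity j odd = begin
    suc j % 2                    ≡⟨ [m+kn]%n≡m%n (suc j) (5 + a) 2 ⟨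
    (suc j + (5 + a) * 2) % 2    ≡⟨ cong (_% 2) (m≡n+o⇒m∸n≡o a (regroup a j)) ⟨
    (a * 3 + 11 + j ∸ a) % 2     ≡⟨ odd ⟩
    1                            ∎
    where open ≡-Reasoning
  decompose : ∀ {n} → ∃ (λ j → a * 3 + 11 + j ≡ n) → (n ∸ a) % 2 ≡ 1 → ∃ λ i → n ≡ a * 3 + 11 + i * 2
  decompose (j , refl) odd with [1+n]%2≡1⇒2∣n j (parity j odd)
  ... | divides i refl = i , refl

n≡3a+2b+1×5≤b : ∀ {n} a → a * 3 + 11 ≤ n → (n ∸ a) % 2 ≡ 1 →
  let b = (n ∸ 3 * a ∸ 1) / 2 in n ≡ 3 * a + 2 * b + 1 × 5 ≤ b
n≡3a+2b+1×5≤b a a*3+11≤n odd with n≡a*3+11+i*2 a a*3+11≤n odd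
... | i , refl = subst (λ b → a * 3 + 11 + i * 2 ≡ 3 * a + 2 * b + 1 × 5 ≤ b) (sym b≡5+i) (regroup a i , m≤m+n 5 i)
  where
  regroup : ∀ a i → a * 3 + 11 + i * 2 ≡ 3 * a + 2 * (5 + i) + 1
  regroup = solve-∀
  shift : ∀ a i → a * 3 + 11 + i * 2 ≡ 3 * a + (11 + i * 2)
  shift = solve-∀
  b≡5+i : (a * 3 + 11 + i * 2 ∸ 3 * a ∸ 1) / 2 ≡ 5 + i
  b≡5+i = trans (cong (λ m → (m ∸ 1) / 2) (m≡n+o⇒m∸n≡o (3 * a) (shift a i))) (m*n/n≡m (5 + i) 2)

lemma3p5 : (n a : ℕ) → 45 ≤ n → (n + 7 + 4) / 5 ≤ a → a ≤ (n ∸ 11) / 3 → (n ∸ a) % 2 ≡ 1 →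
    let b = (n ∸ 3 * a ∸ 1) / 2 in
    (c : ℕ) → b + 2 ≤ c → c ≤ a ∸ 2 →
      IsEigenvalueCayST n (+ (a C 2) - + c)
      × (c ≤ (a + b) / 2 →
          Corresponds n (a ∷ (a + b + 2 ∸ c) ∷ (c + 1) ∷ 4 ∷ ((2 ×ᵣ (c ∸ 3)) ++ (1 ×ᵣ (a + b ∸ 2 * c)))) (+ (a C 2) - + c))
      × ((a + b) / 2 ≤ c →
          Corresponds n (a ∷ (c + 1) ∷ (a + b ∸ c ∸ 1) ∷ ((6 ×ᵣ 2) ++ ((2 ×ᵣ (a + b ∸ c ∸ 7)) ++ (1 ×ᵣ (2 * c + 3 ∸ (a + b)))))) (+ (a C 2) - + c))
lemma3p5 n a 45≤n _ a≤[n∸11]/3 odd c b+2≤c c≤a∸2 =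
  [ (λ h → _ , corresponds-i a b n≡ 5≤b b+2≤c h) , (λ h → _ , corresponds-ii a b n≡ 5≤b b+2≤c c≤a∸2 h) ]′ (≤-total c ((a + b) / 2))
  , corresponds-i a b n≡ 5≤b b+2≤c
  , corresponds-ii a b n≡ 5≤b b+2≤c c≤a∸2
  where
  b : ℕ
  b = (n ∸ 3 * a ∸ 1) / 2
  a*3+11≤n : a * 3 + 11 ≤ n
  a*3+11≤n = m≤o∸n⇒m+n≤o (a * 3) (≤-trans (m≤m+n 11 34) 45≤n) (≤-trans (*-monoˡ-≤ 3 a≤[n∸11]/3) (m/n*n≤m (n ∸ 11) 3))
  n≡ : n ≡ 3 * a + 2 * b + 1
  n≡ = proj₁ (n≡3a+2b+1×5≤b a a*3+11≤n odd)
  5≤b : 5 ≤ b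
  5≤b = proj₂ (n≡3a+2b+1×5≤b a a*3+11≤n odd)
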